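{- Let $n\ge 1$ be an integer and let $M=m/2^n$ where $m$ is an odd integer with $1\le m\le 2^n-1$. Then $M$ has at least $n+1$ distinct EXB codes of resolution $n$.
   Context: An EXB (extended binary) code of resolution $n$ of a number $M$ is a tuple $(A_0,A_1,\dots,A_n)$ of integers with $A_0\in\{0,1\}$ and $A_j\in\{ -1,0,1\}$ for $1\le j\le n$, such that $M=A_0+\sum_{j=1}^{n}A_j2^{ -j}$. -}

module Defs where

open import Data.Nat using (ℕ; zero; suc)
open import Data.Integer using (ℤ; +_; -[1+_])
open import Data.Rational using (ℚ; _+_; _*_; _/_; 0ℚ; 1ℚ)
open import Data.Vec using (Vec; []; _∷_)
open import Data.Product using (_×_)
open import Relation.Binary.PropositionalEquality using (_≡_)

half^ : ℕ → ℚ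
half^ zero    = 1ℚ
half^ (suc j) = (+ 1 / 2) * half^ j

IsBit : ℤ → Set
IsBit a = (a ≡ + 0) Data.Sum.⊎ (a ≡ + 1)
  where import Data.Sum

IsTrit : ℤ → Set
IsTrit a = (a ≡ -[1+ 0 ]) Data.Sum.⊎ ((a ≡ + 0) Data.Sum.⊎ (a ≡ + 1))
  where import Data.Sum

-- A code (A_0, A_1, ..., A_n) is stored as A_0 together with the vector (A_1,...,A_n).
-- Σ_{j=k}^{k+len-1} A_j 2^{-j} for the vector starting at index k
tailValue : ∀ {len} → ℕ → Vec ℤ len → ℚ
tailValue k []       = 0ℚ
tailValue k (a ∷ as) = (a / 1) * half^ k + tailValue (suc k) as

codeValue : ∀ {n} → ℤ → Vec ℤ n → ℚ
codeValue a0 as = (a0 / 1) + tailValue 1 as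

data AllTrit : ∀ {n} → Vec ℤ n → Set where
  []  : AllTrit []
  _∷_ : ∀ {n a} {as : Vec ℤ n} → IsTrit a → AllTrit as → AllTrit (a ∷ as)

IsEXBCode : (n : ℕ) → ℚ → Vec ℤ (suc n) → Set
IsEXBCode n M (a0 ∷ as) = IsBit a0 × AllTrit as × codeValue a0 as ≡ M

dyadic : ℤ → ℕ → ℚ
dyadic m n = (m / 1) * half^ n

-- Read (A₀, A₁, …, Aₙ) as the integer A₀2ⁿ + A₁2ⁿ⁻¹ + ⋯ + Aₙ (Horner's scheme); the
-- code has value m/2ⁿ exactly when this integer is m. An odd m = 2h + 1 is obtained
-- by appending the digit 1 to a code of h, or the digit −1 to a code of h + 1, both at
-- resolution n − 1. Of h and h + 1 one is odd, and by induction has n codes; the other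
-- is even and still has its binary code. Since the last digits differ, this gives
-- n + 1 distinct codes.
{-# OPTIONS --safe #-}
module Submission where

open import Defs
open import Data.Nat using (ℕ; zero; suc; _≤_; _^_; _∸_; z≤n; s≤s)
import Data.Nat as ℕ
import Data.Nat.Properties as ℕₚ
open import Data.Nat.Divisibility using (_∣_; divides)
open import Data.Integer using (ℤ; +_; -[1+_])
import Data.Integer as ℤ
import Data.Integer.Properties as ℤₚ
open import Data.Integer.Tactic.RingSolver using (solve-∀)
open import Data.Rational using (ℚ; mkℚ; -_; _+_; _*_; _/_; 1ℚ)
import Data.Rational.Properties as ℚₚ
open import Data.Rational.Solver using (module +-*-Solver)
import Data.Nat.Coprimality as Coprimality
open import Data.Vec using (Vec; []; _∷_; _∷ʳ_)
open import Data.Vec.Properties using (∷ʳ-injectiveˡ; ∷ʳ-injectiveʳ)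
open import Data.List using (List; []; _∷_; length; map)
open import Data.List.Properties using (length-map)
open import Data.List.Relation.Unary.All using (All; []; _∷_; universal)
import Data.List.Relation.Unary.All as All
open import Data.List.Relation.Unary.All.Properties using (map⁺)
open import Data.List.Relation.Unary.AllPairs using ([]; _∷_)
open import Data.List.Relation.Unary.Unique.Propositional using (Unique)
import Data.List.Relation.Unary.Unique.Propositional.Properties as Uniqueₚ
open import Data.Product using (Σ; _×_; _,_)
open import Data.Sum using (inj₁; inj₂)
open import Relation.Nullary using (¬_; contradiction)
open import Relation.Binary.PropositionalEquality

horner : ∀ {l} → ℤ → Vec ℤ l → ℤ
horner acc []       = acc
horner acc (a ∷ as) = horner (+ 2 ℤ.* acc ℤ.+ a) as

horner-∷ʳ : ∀ {l} acc (as : Vec ℤ l) a → horner acc (as ∷ʳ a) ≡ + 2 ℤ.* horner acc as ℤ.+ a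
horner-∷ʳ acc []       a = refl
horner-∷ʳ acc (b ∷ bs) a = horner-∷ʳ _ bs a

fromℤ : ℤ → ℚ
fromℤ z = z / 1

fromℤ≡mkℚ : ∀ z → fromℤ z ≡ mkℚ z 0 (Coprimality.sym (Coprimality.1-coprimeTo ℤ.∣ z ∣))
fromℤ≡mkℚ (+ n)    = ℚₚ.normalize-coprime (Coprimality.sym (Coprimality.1-coprimeTo n))
fromℤ≡mkℚ -[1+ n ] = cong -_ (ℚₚ.normalize-coprime (Coprimality.sym (Coprimality.1-coprimeTo (suc n))))

fromℤ-+ : ∀ a b → fromℤ (a ℤ.+ b) ≡ fromℤ a + fromℤ b
fromℤ-+ a b rewrite fromℤ≡mkℚ a | fromℤ≡mkℚ b =
  sym (cong₂ (λ x y → fromℤ (x ℤ.+ y)) (ℤₚ.*-identityʳ a) (ℤₚ.*-identityʳ b))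

fromℤ-* : ∀ a b → fromℤ (a ℤ.* b) ≡ fromℤ a * fromℤ b
fromℤ-* a b rewrite fromℤ≡mkℚ a | fromℤ≡mkℚ b = refl

½ : ℚ
½ = + 1 / 2

horner-step-value : ∀ acc a h →
  fromℤ acc * h + fromℤ a * (½ * h) ≡ fromℤ (+ 2 ℤ.* acc ℤ.+ a) * (½ * h)
horner-step-value acc a h = begin
  fromℤ acc * h + fromℤ a * (½ * h)
    ≡⟨ cong (_+ fromℤ a * (½ * h)) (sym (ℚₚ.*-identityˡ (fromℤ acc * h))) ⟩
  1ℚ * (fromℤ acc * h) + fromℤ a * (½ * h)
    ≡⟨ ring (fromℤ (+ 2)) (fromℤ acc) (fromℤ a) ½ h ⟩
  (fromℤ (+ 2) * fromℤ acc + fromℤ a) * (½ * h)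
    ≡⟨ cong (λ t → (t + fromℤ a) * (½ * h)) (sym (fromℤ-* (+ 2) acc)) ⟩
  (fromℤ (+ 2 ℤ.* acc) + fromℤ a) * (½ * h)
    ≡⟨ cong (_* (½ * h)) (sym (fromℤ-+ (+ 2 ℤ.* acc) a)) ⟩
  fromℤ (+ 2 ℤ.* acc ℤ.+ a) * (½ * h) ∎
  where
  open ≡-Reasoning
  open +-*-Solver
  -- ½ * fromℤ (+ 2) computes to 1ℚ, which turns the step into a ring identity.
  ring : ∀ t x y u h → (u * t) * (x * h) + y * (u * h) ≡ (t * x + y) * (u * h)
  ring = solve 5 (λ t x y u h → (u :* t) :* (x :* h) :+ y :* (u :* h) := (t :* x :+ y) :* (u :* h)) refl

tailValue-horner : ∀ {l} acc k (as : Vec ℤ l) →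
  fromℤ acc * half^ k + tailValue (suc k) as ≡ fromℤ (horner acc as) * half^ (k ℕ.+ l)
tailValue-horner acc k [] rewrite ℕₚ.+-identityʳ k = ℚₚ.+-identityʳ _
tailValue-horner {suc l} acc k (a ∷ as) = begin
  fromℤ acc * half^ k + (fromℤ a * half^ (suc k) + tailValue (suc (suc k)) as)
    ≡⟨ sym (ℚₚ.+-assoc (fromℤ acc * half^ k) (fromℤ a * half^ (suc k)) (tailValue (suc (suc k)) as)) ⟩
  fromℤ acc * half^ k + fromℤ a * half^ (suc k) + tailValue (suc (suc k)) as
    ≡⟨ cong (_+ tailValue (suc (suc k)) as) (horner-step-value acc a (half^ k)) ⟩
  fromℤ (+ 2 ℤ.* acc ℤ.+ a) * half^ (suc k) + tailValue (suc (suc k)) as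
    ≡⟨ tailValue-horner _ (suc k) as ⟩
  fromℤ (horner acc (a ∷ as)) * half^ (suc k ℕ.+ l)
    ≡⟨ cong (λ j → fromℤ (horner acc (a ∷ as)) * half^ j) (sym (ℕₚ.+-suc k l)) ⟩
  fromℤ (horner acc (a ∷ as)) * half^ (k ℕ.+ suc l) ∎
  where open ≡-Reasoning

codeValue≡dyadic-horner : ∀ {n} a₀ (as : Vec ℤ n) → codeValue a₀ as ≡ dyadic (horner a₀ as) n
codeValue≡dyadic-horner a₀ as =
  trans (cong (_+ tailValue 1 as) (sym (ℚₚ.*-identityʳ (fromℤ a₀)))) (tailValue-horner a₀ 0 as)

Encodes : ∀ {n} → ℤ → Vec ℤ (suc n) → Set
Encodes m (a₀ ∷ as) = IsBit a₀ × AllTrit as × horner a₀ as ≡ m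

Encodes⇒IsEXBCode : ∀ {n m} {w : Vec ℤ (suc n)} → Encodes m w → IsEXBCode n (dyadic m n) w
Encodes⇒IsEXBCode {n} {w = a₀ ∷ as} (bit , trits , value) =
  bit , trits , trans (codeValue≡dyadic-horner a₀ as) (cong (λ z → dyadic z n) value)

allTrit-∷ʳ : ∀ {l} {as : Vec ℤ l} {a} → AllTrit as → IsTrit a → AllTrit (as ∷ʳ a)
allTrit-∷ʳ []       t = t ∷ []
allTrit-∷ʳ (u ∷ us) t = u ∷ allTrit-∷ʳ us t

encodes-∷ʳ : ∀ {n m m′ a} {w : Vec ℤ (suc n)} → IsTrit a → + 2 ℤ.* m ℤ.+ a ≡ m′ →
             Encodes m w → Encodes m′ (w ∷ʳ a)
encodes-∷ʳ {w = a₀ ∷ as} t eq (bit , trits , value) =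
  bit , allTrit-∷ʳ trits t , trans (horner-∷ʳ a₀ as _) (trans (cong (λ z → + 2 ℤ.* z ℤ.+ _) value) eq)

-- + (2 * h) unfolds to + h ℤ.+ (+ h ℤ.+ + 0), hence the shape of these ring identities.
2*h+0≡2*h : ∀ h → + 2 ℤ.* + h ℤ.+ + 0 ≡ + (2 ℕ.* h)
2*h+0≡2*h h = identity (+ h)
  where
  identity : ∀ x → + 2 ℤ.* x ℤ.+ + 0 ≡ x ℤ.+ (x ℤ.+ + 0)
  identity = solve-∀

2*h+1≡1+2*h : ∀ h → + 2 ℤ.* + h ℤ.+ + 1 ≡ + suc (2 ℕ.* h)
2*h+1≡1+2*h h = identity (+ h)
  where
  identity : ∀ x → + 2 ℤ.* x ℤ.+ + 1 ≡ + 1 ℤ.+ (x ℤ.+ (x ℤ.+ + 0))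
  identity = solve-∀

2*[1+h]-1≡1+2*h : ∀ h → + 2 ℤ.* + suc h ℤ.+ -[1+ 0 ] ≡ + suc (2 ℕ.* h)
2*[1+h]-1≡1+2*h h = identity (+ h)
  where
  identity : ∀ x → + 2 ℤ.* (+ 1 ℤ.+ x) ℤ.+ -[1+ 0 ] ≡ + 1 ℤ.+ (x ℤ.+ (x ℤ.+ + 0))
  identity = solve-∀

data Parity : ℕ → Set where
  even : ∀ h → Parity (2 ℕ.* h)
  odd  : ∀ h → Parity (suc (2 ℕ.* h))

parity : ∀ m → Parity m
parity zero = even 0
parity (suc m) with parity m
... | even h = odd h
... | odd h  = subst Parity (cong suc (ℕₚ.+-suc h (h ℕ.+ 0))) (even (suc h))

binaryCode : ∀ n m → m ≤ 2 ^ n → Σ (Vec ℤ (suc n)) (Encodes (+ m))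
binaryCode zero zero          _             = + 0 ∷ [] , inj₁ refl , [] , refl
binaryCode zero (suc zero)    _             = + 1 ∷ [] , inj₂ refl , [] , refl
binaryCode zero (suc (suc m)) (s≤s ())
binaryCode (suc n) m m≤2^n with parity m
... | even h =
  let w , code = binaryCode n h (ℕₚ.*-cancelˡ-≤ 2 m≤2^n)
  in  w ∷ʳ + 0 , encodes-∷ʳ (inj₂ (inj₁ refl)) (2*h+0≡2*h h) code
... | odd h =
  let w , code = binaryCode n h (ℕₚ.<⇒≤ (ℕₚ.*-cancelˡ-< 2 _ _ m≤2^n))
  in  w ∷ʳ + 1 , encodes-∷ʳ (inj₂ (inj₂ refl)) (2*h+1≡1+2*h h) code

DistinctCodes : ℕ → ℤ → Set
DistinctCodes n m =
  Σ (List (Vec ℤ (suc n))) λ codes → Unique codes × All (Encodes m) codes × suc n ≤ length codes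

distinctCodes-∷ʳ : ∀ {n m m′ a b} {w : Vec ℤ (suc n)} → IsTrit a → + 2 ℤ.* m ℤ.+ a ≡ m′ →
  a ≢ b → Encodes m′ (w ∷ʳ b) → DistinctCodes n m → DistinctCodes (suc n) m′
distinctCodes-∷ʳ {n} {a = a} {b} {w} t eq a≢b code (codes , unique , encode , enough) =
  (w ∷ʳ b) ∷ map (_∷ʳ a) codes ,
  map⁺ (universal (λ v same → a≢b (sym (∷ʳ-injectiveʳ w v same))) codes)
    ∷ Uniqueₚ.map⁺ (∷ʳ-injectiveˡ _ _) unique ,
  code ∷ map⁺ (All.map (encodes-∷ʳ t eq) encode) ,
  s≤s (subst (suc n ≤_) (sym (length-map (_∷ʳ a) codes)) enough)

distinctCodes-odd : ∀ n h → suc (2 ℕ.* h) ≤ 2 ^ n → DistinctCodes n (+ suc (2 ℕ.* h))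
distinctCodes-odd zero    zero    _        = (+ 1 ∷ []) ∷ [] , [] ∷ [] , (inj₂ refl , [] , refl) ∷ [] , s≤s z≤n
distinctCodes-odd zero    (suc h) (s≤s ())
distinctCodes-odd (suc k) h       2h+1≤2^n with ℕₚ.*-cancelˡ-< 2 h (2 ^ k) 2h+1≤2^n | parity h
... | h<2^k | even q =
  let _ , code = binaryCode k h (ℕₚ.<⇒≤ h<2^k)
  in  distinctCodes-∷ʳ (inj₁ refl) (2*[1+h]-1≡1+2*h h) (λ ())
        (encodes-∷ʳ (inj₂ (inj₂ refl)) (2*h+1≡1+2*h h) code) (distinctCodes-odd k q h<2^k)
... | h<2^k | odd q =
  let _ , code = binaryCode k (suc h) h<2^k
  in  distinctCodes-∷ʳ (inj₂ (inj₂ refl)) (2*h+1≡1+2*h h) (λ ())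
        (encodes-∷ʳ (inj₁ refl) (2*[1+h]-1≡1+2*h h) code) (distinctCodes-odd k q (ℕₚ.<⇒≤ h<2^k))

corollary1 : (n : ℕ) → 1 ≤ n → (m : ℕ) → ¬ (2 ∣ m) → 1 ≤ m → m ≤ 2 ^ n ∸ 1 →
    Σ (List (Vec ℤ (suc n))) λ codes →
      Unique codes × All (IsEXBCode n (dyadic (+ m) n)) codes × suc n ≤ length codes
corollary1 n _ m m-odd _ m≤2^n-1 with parity m
... | even h = contradiction (divides h (ℕₚ.*-comm 2 h)) m-odd
... | odd h =
  let codes , unique , encode , enough = distinctCodes-odd n h (ℕₚ.≤-trans m≤2^n-1 (ℕₚ.m∸n≤m (2 ^ n) 1))
  in  codes , unique , All.map Encodes⇒IsEXBCode encode , enough
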